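{- For all nonnegative integers $N$, $$\Delta p\!\left(\left\lfloor\tfrac{5N}{2}\right\rfloor,5,N\right)=\begin{cases}p(n,3),&N=4n,\\ p(n-1,3)+p(n-3,3),&N=4n+1,\\ p(n-4,3),&N=4n+2,\\ p(n-1,3)+p(n-2,3),&N=4n+3.\end{cases}$$
   Context: $p(n,m,N)$ is the number of partitions of $n$ into at most $m$ parts, each at most $N$ (the coefficient of $q^n$ in the Gaussian polynomial $\begin{bmatrix}N+m\\ m\end{bmatrix}_q$); $p(n,m)$ is the number of partitions of $n$ into at most $m$ parts; both are $0$ for $n<0$ and $p(0,m)=1$. $\Delta p(n,m,N):=p(n,m,N)-p(n-1,m,N)$. -}

module Defs where

open import Data.Nat using (ℕ; zero; suc; _+_; _∸_; _*_; _≤ᵇ_)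
open import Data.Bool using (if_then_else_)
open import Data.Integer as ℤ using (ℤ; +_; -[1+_])

-- pBounded n m N : number of partitions of n into at most m parts, each at most N.
-- Recursion on the part bound N: classify partitions by the number j (0 ≤ j ≤ m)
-- of parts equal to N; the remaining parts form a partition of n - j*N into at
-- most m - j parts, each at most N - 1 (requires j*N ≤ n).
pBounded : ℕ → ℕ → ℕ → ℕ
pBounded zero    m zero    = 1
pBounded (suc n) m zero    = 0
pBounded n       m (suc N) = go m m
  where
  go : ℕ → ℕ → ℕ
  go zero    r = pBounded n r N
  go (suc j) r =
    go j r + (if suc j * suc N ≤ᵇ n then pBounded (n ∸ suc j * suc N) (r ∸ suc j) N else 0)

-- pParts n m : number of partitions of n into at most m parts
-- (every part of a partition of n is at most n).
pParts : ℕ → ℕ → ℕ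
pParts n m = pBounded n m n

p3 : ℤ → ℕ → ℕ → ℕ
p3 (+ n)    m N = pBounded n m N
p3 -[1+ _ ] m N = 0

p2 : ℤ → ℕ → ℕ
p2 (+ n)    m = pParts n m
p2 -[1+ _ ] m = 0

Δp : ℤ → ℕ → ℕ → ℤ
Δp n m N = (+ p3 n m N) ℤ.- (+ p3 (n ℤ.- + 1) m N)

-- With G_N(q) = Σ p(n,5,N) qⁿ = ∏_{i=1}^{5} (1 − q^{N+i}) / (1 − q^i), the differences Δp(·,5,N) have generating
-- function ∏_{i=1}^{5} (1 − q^{N+i}) · R(q), where R = 1/((1 − q²)(1 − q³)(1 − q⁴)(1 − q⁵)). Expanding the product,
-- Δp(t,5,N) is a signed sum of values R(t − |S|·N − ΣS) over S ⊆ {1, …, 5}. For N = 4n + c and t = ⌊5N/2⌋ the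
-- subsets with |S| ≥ 3 contribute nothing, and the others give R along the progressions 10n + b, 6n + b, 2n + b.
-- Each of these sequences of n, like n ↦ p(n − b, 3), is annihilated by (1 − q)(1 − q³)(1 − q²)(1 − q⁵) acting
-- on n, since this polynomial evaluated at q^(2k+2) is divisible by the denominator of R (and at q by
-- (1 − q)(1 − q²)(1 − q³)). Both sides of each identity therefore obey one linear recurrence of order 11, and
-- comparing their first 11 values by computation proves it for every n.

module Submission where

open import Data.Bool using (if_then_else_; true; false; T)
open import Data.Empty using (⊥-elim)
open import Data.Integer as ℤ using (ℤ; +_; -[1+_])
import Data.Integer.Properties as ℤP
open import Data.Integer.Tactic.RingSolver using (solve-∀)
open import Data.List using (List; []; _∷_; _++_; map; replicate; take; length; drop; upTo)
open import Data.List.Relation.Unary.All as All using (All; []; _∷_; all?)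
import Data.List.Relation.Unary.All.Properties as All
open import Data.Nat using (ℕ; zero; suc; _+_; _*_; _∸_; _/_; _≤_; _<_; _≤ᵇ_; _≤?_; _<?_; z≤n; s≤s; z<s)
open import Data.Nat.ListAction using (sum)
open import Data.Nat.Properties
import Data.Nat.Tactic.RingSolver as ℕ-Ring
open import Data.Nat.DivMod using (+-distrib-/-∣ʳ; m*n/n≡m)
open import Data.Nat.Divisibility using (n∣m*n)
open import Data.Nat.Induction using (<-rec)
open import Data.Product using (_×_; _,_; proj₁; proj₂)
open import Data.Unit using (tt)
open import Function using (_∘_)
open import Relation.Nullary using (Dec; yes; no; ¬_)
open import Relation.Unary using (Decidable)
open import Relation.Nullary.Decidable using (True; toWitness; _×-dec_)
open import Relation.Binary.PropositionalEquality
open ≡-Reasoning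

open import Defs

pos-∸ : ∀ {m n} → n ≤ m → + m ℤ.- + n ≡ + (m ∸ n)
pos-∸ {m} {n} n≤m = trans (ℤP.m-n≡m⊖n m n) (ℤP.⊖-≥ n≤m)

i-m-n≡i-[m+n] : ∀ i m n → i ℤ.- + m ℤ.- + n ≡ i ℤ.- + (m + n)
i-m-n≡i-[m+n] i m n = trans (ring i (+ m) (+ n)) (cong (λ j → i ℤ.- j) (sym (ℤP.pos-+ m n)))
  where
  ring : ∀ i j k → i ℤ.- j ℤ.- k ≡ i ℤ.- (j ℤ.+ k)
  ring = solve-∀

i-j-k≡i-k-j : ∀ i j k → i ℤ.- j ℤ.- k ≡ i ℤ.- k ℤ.- j
i-j-k≡i-k-j = solve-∀

pos[m+n]-pos[m+o]≡n-o : ∀ m n o → + (m + n) ℤ.- + (m + o) ≡ + n ℤ.- + o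
pos[m+n]-pos[m+o]≡n-o m n o =
  trans (cong₂ ℤ._-_ (ℤP.pos-+ m n) (ℤP.pos-+ m o)) (ring (+ m) (+ n) (+ o))
  where
  ring : ∀ i j k → i ℤ.+ j ℤ.- (i ℤ.+ k) ≡ j ℤ.- k
  ring = solve-∀

-- Integer sequences as power series

Seq : Set
Seq = ℤ → ℤ

Causal : Seq → Set
Causal f = ∀ n → f -[1+ n ] ≡ + 0

VanishesFrom : ℕ → Seq → Set
VanishesFrom B f = ∀ n → B ≤ n → f (+ n) ≡ + 0

vanishesFrom-≤ : ∀ {B B′ f} → B ≤ B′ → VanishesFrom B f → VanishesFrom B′ f
vanishesFrom-≤ B≤B′ v n B′≤n = v n (≤-trans B≤B′ B′≤n)

vanishesFrom-≗ : ∀ {B f g} → f ≗ g → VanishesFrom B f → VanishesFrom B g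
vanishesFrom-≗ f≗g v n B≤n = trans (sym (f≗g (+ n))) (v n B≤n)

causal-below : ∀ f → Causal f → ∀ {n a} → n < a → f (+ n ℤ.- + a) ≡ + 0
causal-below f f-causal {n} {suc a} (s≤s n≤a) = begin
  f (+ n ℤ.- + suc a)    ≡⟨ cong f (trans (ℤP.m-n≡m⊖n n (suc a)) (ℤP.⊖-< (s≤s n≤a))) ⟩
  f (ℤ.- + (suc a ∸ n))  ≡⟨ cong (λ k → f (ℤ.- + k)) (+-∸-assoc 1 n≤a) ⟩
  f -[1+ a ∸ n ]         ≡⟨ f-causal (a ∸ n) ⟩
  + 0                    ∎

δ : Seq
δ (+ zero)   = + 1
δ (+ suc _)  = + 0
δ -[1+ _ ]   = + 0

δ-vanishesFrom-1 : VanishesFrom 1 δ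
δ-vanishesFrom-1 (suc n) _ = refl

-- Multiplication by 1 − q^a

∇ : ℕ → Seq → Seq
∇ a f t = f t ℤ.- f (t ℤ.- + a)

∇-cong : ∀ a {f g} → f ≗ g → ∇ a f ≗ ∇ a g
∇-cong a f≗g t = cong₂ ℤ._-_ (f≗g t) (f≗g (t ℤ.- + a))

∇-+ : ∀ a f g → ∇ a (λ t → f t ℤ.+ g t) ≗ λ t → ∇ a f t ℤ.+ ∇ a g t
∇-+ a f g t = ring (f t) (g t) (f (t ℤ.- + a)) (g (t ℤ.- + a))
  where
  ring : ∀ x y z w → x ℤ.+ y ℤ.- (z ℤ.+ w) ≡ x ℤ.- z ℤ.+ (y ℤ.- w)
  ring = solve-∀

∇-- : ∀ a f g → ∇ a (λ t → f t ℤ.- g t) ≗ λ t → ∇ a f t ℤ.- ∇ a g t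
∇-- a f g t = ring (f t) (g t) (f (t ℤ.- + a)) (g (t ℤ.- + a))
  where
  ring : ∀ x y z w → x ℤ.- y ℤ.- (z ℤ.- w) ≡ x ℤ.- z ℤ.- (y ℤ.- w)
  ring = solve-∀

∇-* : ∀ a s f → ∇ a (λ t → s ℤ.* f t) ≗ λ t → s ℤ.* ∇ a f t
∇-* a s f t = ring s (f t) (f (t ℤ.- + a))
  where
  ring : ∀ s x y → s ℤ.* x ℤ.- s ℤ.* y ≡ s ℤ.* (x ℤ.- y)
  ring = solve-∀

∇-shift : ∀ a s f → ∇ a (λ t → f (t ℤ.- s)) ≗ λ t → ∇ a f (t ℤ.- s)
∇-shift a s f t = cong (λ x → f (t ℤ.- s) ℤ.- f x) (i-j-k≡i-k-j t (+ a) s)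

∇-comm : ∀ a b f → ∇ a (∇ b f) ≗ ∇ b (∇ a f)
∇-comm a b f t =
  trans (cong (λ x → ∇ b f t ℤ.- (f (t ℤ.- + a) ℤ.- f x)) (i-j-k≡i-k-j t (+ a) (+ b)))
        (ring (f t) (f (t ℤ.- + b)) (f (t ℤ.- + a)) (f (t ℤ.- + b ℤ.- + a)))
  where
  ring : ∀ x y z w → x ℤ.- y ℤ.- (z ℤ.- w) ≡ x ℤ.- z ℤ.- (y ℤ.- w)
  ring = solve-∀

∇-causal : ∀ a f → Causal f → Causal (∇ a f)
∇-causal a f f-causal n =
  cong₂ ℤ._-_ (f-causal n) (trans (cong f (ℤP.neg-minus-pos n a)) (f-causal (a + n)))

∇-split : ∀ a b f t → ∇ (a + b) f t ≡ ∇ a f t ℤ.+ ∇ b f (t ℤ.- + a)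
∇-split a b f t = begin
  f t ℤ.- f (t ℤ.- + (a + b))    ≡⟨ cong (λ x → f t ℤ.- f x) (sym (i-m-n≡i-[m+n] t a b)) ⟩
  f t ℤ.- f (t ℤ.- + a ℤ.- + b)  ≡⟨ telescope (f t) (f (t ℤ.- + a)) _ ⟩
  ∇ a f t ℤ.+ ∇ b f (t ℤ.- + a)  ∎
  where
  telescope : ∀ x y z → x ℤ.- z ≡ (x ℤ.- y) ℤ.+ (y ℤ.- z)
  telescope = solve-∀

∇0≡0 : ∀ g t → ∇ 0 g t ≡ + 0
∇0≡0 g t = trans (cong (λ x → g t ℤ.- g x) (ℤP.+-identityʳ t)) (ℤP.+-inverseʳ (g t))

∇-vanishesFrom : ∀ a {B g} → VanishesFrom B g → VanishesFrom (B + a) (∇ a g)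
∇-vanishesFrom a {B} {g} v n B+a≤n = begin
  g (+ n) ℤ.- g (+ n ℤ.- + a)
    ≡⟨ cong (λ x → g (+ n) ℤ.- g x) (pos-∸ (m+n≤o⇒n≤o B B+a≤n)) ⟩
  g (+ n) ℤ.- g (+ (n ∸ a))
    ≡⟨ cong₂ ℤ._-_ (v n (m+n≤o⇒m≤o B B+a≤n)) (v (n ∸ a) (m+n≤o⇒m≤o∸n B B+a≤n)) ⟩
  + 0 ∎

-- 1 − q^((m+1)j) = (1 − q^j)(1 + q^j + ⋯ + q^(mj))
∇-multiple : ∀ m {j B g} → VanishesFrom B (∇ j g) → VanishesFrom (B + m * j) (∇ (suc m * j) g)
∇-multiple zero {j} {B} {g} v n B+0≤n = begin
  ∇ (j + 0) g (+ n)                    ≡⟨ ∇-split j 0 g (+ n) ⟩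
  ∇ j g (+ n) ℤ.+ ∇ 0 g (+ n ℤ.- + j)  ≡⟨ cong₂ ℤ._+_ (v n (m+n≤o⇒m≤o B B+0≤n)) (∇0≡0 g _) ⟩
  + 0                                  ∎
∇-multiple (suc m) {j} {B} {g} v n le = begin
  ∇ (j + suc m * j) g (+ n)
    ≡⟨ ∇-split j (suc m * j) g (+ n) ⟩
  ∇ j g (+ n) ℤ.+ ∇ (suc m * j) g (+ n ℤ.- + j)
    ≡⟨ cong (λ x → ∇ j g (+ n) ℤ.+ ∇ (suc m * j) g x) (pos-∸ j≤n) ⟩
  ∇ j g (+ n) ℤ.+ ∇ (suc m * j) g (+ (n ∸ j))
    ≡⟨ cong₂ ℤ._+_ (v n (m+n≤o⇒m≤o B le)) (∇-multiple m {g = g} v (n ∸ j) rest≤) ⟩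
  + 0 ∎
  where
  reorder : B + suc m * j ≡ B + m * j + j
  reorder = trans (cong (λ x → B + x) (+-comm j (m * j))) (sym (+-assoc B (m * j) j))
  j≤n : j ≤ n
  j≤n = m+n≤o⇒n≤o (B + m * j) (≤-trans (≤-reflexive (sym reorder)) le)
  rest≤ : B + m * j ≤ n ∸ j
  rest≤ = m+n≤o⇒m≤o∸n (B + m * j) (≤-trans (≤-reflexive (sym reorder)) le)

∇* : List ℕ → Seq → Seq
∇* []       f = f
∇* (a ∷ as) f = ∇ a (∇* as f)

∇*-cong : ∀ as {f g} → f ≗ g → ∇* as f ≗ ∇* as g
∇*-cong []       f≗g = f≗g
∇*-cong (a ∷ as) f≗g = ∇-cong a (∇*-cong as f≗g)

∇*-+ : ∀ as f g → ∇* as (λ t → f t ℤ.+ g t) ≗ λ t → ∇* as f t ℤ.+ ∇* as g t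
∇*-+ []       f g t = refl
∇*-+ (a ∷ as) f g t = trans (∇-cong a (∇*-+ as f g) t) (∇-+ a (∇* as f) (∇* as g) t)

∇*-- : ∀ as f g → ∇* as (λ t → f t ℤ.- g t) ≗ λ t → ∇* as f t ℤ.- ∇* as g t
∇*-- []       f g t = refl
∇*-- (a ∷ as) f g t = trans (∇-cong a (∇*-- as f g) t) (∇-- a (∇* as f) (∇* as g) t)

∇*-* : ∀ as s f → ∇* as (λ t → s ℤ.* f t) ≗ λ t → s ℤ.* ∇* as f t
∇*-* []       s f t = refl
∇*-* (a ∷ as) s f t = trans (∇-cong a (∇*-* as s f) t) (∇-* a s (∇* as f) t)

∇*-shift : ∀ as s f → ∇* as (λ t → f (t ℤ.- s)) ≗ λ t → ∇* as f (t ℤ.- s)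
∇*-shift []       s f t = refl
∇*-shift (a ∷ as) s f t = trans (∇-cong a (∇*-shift as s f) t) (∇-shift a s (∇* as f) t)

∇*-const0 : ∀ as t → ∇* as (λ _ → + 0) t ≡ + 0
∇*-const0 []       t = refl
∇*-const0 (a ∷ as) t = cong₂ ℤ._-_ (∇*-const0 as t) (∇*-const0 as _)

∇*-causal : ∀ as f → Causal f → Causal (∇* as f)
∇*-causal []       f f-causal = f-causal
∇*-causal (a ∷ as) f f-causal = ∇-causal a (∇* as f) (∇*-causal as f f-causal)

∇*-∇ : ∀ as a f → ∇* as (∇ a f) ≗ ∇ a (∇* as f)
∇*-∇ []       a f t = refl
∇*-∇ (b ∷ as) a f t = trans (∇-cong b (∇*-∇ as a f) t) (∇-comm b a (∇* as f) t)

∇*-∇* : ∀ as bs f → ∇* as (∇* bs f) ≗ ∇* bs (∇* as f)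
∇*-∇* as []       f t = refl
∇*-∇* as (b ∷ bs) f t = trans (∇*-∇ as b (∇* bs f) t) (∇-cong b (∇*-∇* as bs f) t)

∇*-local : ∀ as {f g t} → (∀ x → x ℤ.≤ t → f x ≡ g x) → ∇* as f t ≡ ∇* as g t
∇*-local []       agree = agree _ ℤP.≤-refl
∇*-local (a ∷ as) {t = t} agree =
  cong₂ ℤ._-_ (∇*-local as agree)
              (∇*-local as (λ x x≤ → agree x (ℤP.≤-trans x≤ (ℤP.i-j≤i t (+ a)))))

∇-vanishing⇒zero : ∀ a g {n₀} → Causal g → (∀ n → n < n₀ → g (+ n) ≡ + 0) →
              VanishesFrom n₀ (∇ (suc a) g) → ∀ n → g (+ n) ≡ + 0
∇-vanishing⇒zero a g {n₀} g-causal below v = <-rec _ step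
  where
  step : ∀ n → (∀ {m} → m < n → g (+ m) ≡ + 0) → g (+ n) ≡ + 0
  step n rec with n <? n₀
  ... | yes n<n₀ = below n n<n₀
  ... | no  n≮n₀ = begin
    g (+ n)                                       ≡⟨ split (g (+ n)) (g (+ n ℤ.- + suc a)) ⟩
    ∇ (suc a) g (+ n) ℤ.+ g (+ n ℤ.- + suc a)     ≡⟨ cong₂ ℤ._+_ (v n (≮⇒≥ n≮n₀)) earlier ⟩
    + 0                                           ∎
    where
    split : ∀ x y → x ≡ (x ℤ.- y) ℤ.+ y
    split = solve-∀
    earlier : g (+ n ℤ.- + suc a) ≡ + 0
    earlier with suc a ≤? n
    ... | yes a<n = trans (cong g (pos-∸ a<n)) (rec (∸-monoʳ-< z<s a<n))
    ... | no  a≮n = causal-below g g-causal (≰⇒> a≮n)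

∇*-vanishing⇒zero : ∀ as h {n₀} → All (0 <_) as → Causal h → (∀ n → n < n₀ → h (+ n) ≡ + 0) →
               VanishesFrom n₀ (∇* as h) → ∀ n → h (+ n) ≡ + 0
∇*-vanishing⇒zero [] h {n₀} [] _ below v n with n <? n₀
... | yes n<n₀ = below n n<n₀
... | no  n≮n₀ = v n (≮⇒≥ n≮n₀)
∇*-vanishing⇒zero (suc a ∷ as) h {n₀} (_ ∷ positive) h-causal below v =
  ∇*-vanishing⇒zero as h positive h-causal below (λ n _ → ∇*h-zero n)
  where
  h-zero-upto : ∀ {n} → (∀ m → m < suc n → h (+ m) ≡ + 0) → ∀ x → x ℤ.≤ + n → h x ≡ + 0
  h-zero-upto _      -[1+ k ] _            = h-causal k
  h-zero-upto h≡0 (+ k)    (ℤ.+≤+ k≤n) = h≡0 k (s≤s k≤n)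
  ∇*h-below : ∀ n → n < n₀ → ∇* as h (+ n) ≡ + 0
  ∇*h-below n n<n₀ =
    trans (∇*-local as (h-zero-upto (λ m m≤n → below m (<-≤-trans m≤n n<n₀))))
          (∇*-const0 as (+ n))
  ∇*h-zero : ∀ n → ∇* as h (+ n) ≡ + 0
  ∇*h-zero = ∇-vanishing⇒zero a (∇* as h) (∇*-causal as h h-causal) ∇*h-below v

∇*-injective : ∀ as {f g} → All (0 <_) as → Causal f → Causal g → ∇* as f ≗ ∇* as g → f ≗ g
∇*-injective as {f} {g} positive f-causal g-causal same (+ n) =
  ℤP.i-j≡0⇒i≡j (f (+ n)) (g (+ n))
    (∇*-vanishing⇒zero as (λ t → f t ℤ.- g t) {0} positive
      (λ k → cong₂ ℤ._-_ (f-causal k) (g-causal k)) (λ _ ())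
      (λ k _ → trans (∇*-- as f g (+ k)) (ℤP.i≡j⇒i-j≡0 (same (+ k)))) n)
∇*-injective as positive f-causal g-causal same -[1+ n ] = trans (f-causal n) (sym (g-causal n))

scaledBy : ℕ × ℕ → ℕ
scaledBy (m , j) = suc m * j

excess : ℕ × ℕ → ℕ
excess (m , j) = m * j

∇*-multiples : ∀ mjs {B f} → VanishesFrom B (∇* (map proj₂ mjs) f) →
               VanishesFrom (B + sum (map excess mjs)) (∇* (map scaledBy mjs) f)
∇*-multiples [] {B} {f} v = vanishesFrom-≤ {f = f} (m≤m+n B 0) v
∇*-multiples ((m , j) ∷ mjs) {B} {f} v =
  vanishesFrom-≤ {f = ∇* (map scaledBy ((m , j) ∷ mjs)) f} (≤-reflexive bound)
    (∇-multiple m {g = ∇* (map scaledBy mjs) f}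
      (vanishesFrom-≗ (∇*-∇ (map scaledBy mjs) j f)
        (∇*-multiples mjs {f = ∇ j f}
          (vanishesFrom-≗ {f = ∇ j (∇* (map proj₂ mjs) f)} (λ t → sym (∇*-∇ (map proj₂ mjs) j f t)) v))))
  where
  S = sum (map excess mjs)
  bound : B + S + m * j ≡ B + (m * j + S)
  bound = trans (+-assoc B S (m * j)) (cong (λ x → B + x) (+-comm S (m * j)))

-- Coefficient lists

Poly : Set
Poly = List ℤ

_⋆_ : Poly → Seq → Seq
([]      ⋆ f) t = + 0
((c ∷ p) ⋆ f) t = c ℤ.* f t ℤ.+ (p ⋆ f) (t ℤ.- + 1)

⋆-causal : ∀ p f → Causal f → Causal (p ⋆ f)
⋆-causal []      f f-causal n = refl
⋆-causal (c ∷ p) f f-causal n =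
  cong₂ ℤ._+_ (trans (cong (c ℤ.*_) (f-causal n)) (ℤP.*-zeroʳ c)) (⋆-causal p f f-causal _)

_⊕_ : Poly → Poly → Poly
[]      ⊕ q       = q
(a ∷ p) ⊕ []      = a ∷ p
(a ∷ p) ⊕ (b ∷ q) = a ℤ.+ b ∷ p ⊕ q

⊕-⋆ : ∀ p q f t → ((p ⊕ q) ⋆ f) t ≡ (p ⋆ f) t ℤ.+ (q ⋆ f) t
⊕-⋆ []      q       f t = sym (ℤP.+-identityˡ _)
⊕-⋆ (a ∷ p) []      f t = sym (ℤP.+-identityʳ _)
⊕-⋆ (a ∷ p) (b ∷ q) f t =
  trans (cong (λ y → (a ℤ.+ b) ℤ.* f t ℤ.+ y) (⊕-⋆ p q f _)) (ring a b (f t) _ _)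
  where
  ring : ∀ a b x y z → (a ℤ.+ b) ℤ.* x ℤ.+ (y ℤ.+ z) ≡ (a ℤ.* x ℤ.+ y) ℤ.+ (b ℤ.* x ℤ.+ z)
  ring = solve-∀

neg-⋆ : ∀ p f t → (map ℤ.-_ p ⋆ f) t ≡ ℤ.- (p ⋆ f) t
neg-⋆ []      f t = refl
neg-⋆ (c ∷ p) f t = trans (cong (λ y → ℤ.- c ℤ.* f t ℤ.+ y) (neg-⋆ p f _)) (ring c (f t) _)
  where
  ring : ∀ c x y → ℤ.- c ℤ.* x ℤ.+ ℤ.- y ≡ ℤ.- (c ℤ.* x ℤ.+ y)
  ring = solve-∀

shift-⋆ : ∀ a p f t → ((replicate a (+ 0) ++ p) ⋆ f) t ≡ (p ⋆ f) (t ℤ.- + a)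
shift-⋆ zero    p f t = cong (p ⋆ f) (sym (ℤP.+-identityʳ t))
shift-⋆ (suc a) p f t =
  trans (ℤP.+-identityˡ _) (trans (shift-⋆ a p f _) (cong (p ⋆ f) (i-m-n≡i-[m+n] t 1 a)))

∇poly : ℕ → Poly → Poly
∇poly a p = p ⊕ (replicate a (+ 0) ++ map ℤ.-_ p)

∇poly-⋆ : ∀ a p f → ∇poly a p ⋆ f ≗ ∇ a (p ⋆ f)
∇poly-⋆ a p f t =
  trans (⊕-⋆ p _ f t)
        (cong (λ y → (p ⋆ f) t ℤ.+ y) (trans (shift-⋆ a (map ℤ.-_ p) f t) (neg-⋆ p f _)))

∏∇poly : List ℕ → Poly
∏∇poly []       = + 1 ∷ []
∏∇poly (a ∷ as) = ∇poly a (∏∇poly as)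

∏∇poly-⋆ : ∀ as f → ∏∇poly as ⋆ f ≗ ∇* as f
∏∇poly-⋆ []       f t = trans (ℤP.+-identityʳ _) (ℤP.*-identityˡ (f t))
∏∇poly-⋆ (a ∷ as) f t = trans (∇poly-⋆ a (∏∇poly as) f t) (∇-cong a (∏∇poly-⋆ as f) t)

dot : Poly → List ℤ → ℤ
dot (c ∷ p) (x ∷ w) = c ℤ.* x ℤ.+ dot p w
dot _       _       = + 0

past : Seq → ℤ → ℕ → List ℤ
past f t zero    = []
past f t (suc k) = f t ∷ past f (t ℤ.- + 1) k

dot-past : ∀ p f t k → length p ≤ k → dot p (past f t k) ≡ (p ⋆ f) t
dot-past []      f t k       _          = refl
dot-past (c ∷ p) f t (suc k) (s≤s p≤k) = cong (λ y → c ℤ.* f t ℤ.+ y) (dot-past p f _ k p≤k)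

take-past : ∀ f t k → take k (past f t (suc k)) ≡ past f t k
take-past f t zero    = refl
take-past f t (suc k) = cong (f t ∷_) (take-past f _ k)

past-causal : ∀ f → Causal f → ∀ n k → past f -[1+ n ] k ≡ replicate k (+ 0)
past-causal f f-causal n zero    = refl
past-causal f f-causal n (suc k) = cong₂ _∷_ (f-causal n) (past-causal f f-causal _ k)

-- inverse holds the coefficients of 1/(1 + q·p(q)); the sliding window makes them cheap to evaluate,
-- which the finite checks in the final step rely on.
module Inverse (p : Poly) where

  window : ℕ → List ℤ
  window zero    = + 1 ∷ replicate (length p) (+ 0)
  window (suc t) = step (window t)
    where
    step : List ℤ → List ℤ
    step w = ℤ.- dot p w ∷ take (length p) w

  inverse : Seq
  inverse (+ zero)  = + 1
  inverse (+ suc t) = ℤ.- dot p (window t)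
  inverse -[1+ _ ]  = + 0

  window-past : ∀ t → window t ≡ past inverse (+ t) (suc (length p))
  window-past zero    = cong (+ 1 ∷_) (sym (past-causal inverse (λ _ → refl) 0 (length p)))
  window-past (suc t) = cong (inverse (+ suc t) ∷_) (begin
    take (length p) (window t)                             ≡⟨ cong (take (length p)) (window-past t) ⟩
    take (length p) (past inverse (+ t) (suc (length p)))  ≡⟨ take-past inverse (+ t) (length p) ⟩
    past inverse (+ t) (length p)                          ∎)

  inverse-spec : (+ 1 ∷ p) ⋆ inverse ≗ δ
  inverse-spec (+ zero)  = cong (λ y → + 1 ℤ.+ y) (⋆-causal p inverse (λ _ → refl) 0)
  inverse-spec (+ suc t) = begin
    + 1 ℤ.* ℤ.- dot p (window t) ℤ.+ (p ⋆ inverse) (+ t)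
      ≡⟨ cong (λ w → + 1 ℤ.* ℤ.- dot p (window t) ℤ.+ w) (sym window-dot) ⟩
    + 1 ℤ.* ℤ.- dot p (window t) ℤ.+ dot p (window t)
      ≡⟨ ring (dot p (window t)) ⟩
    + 0 ∎
    where
    window-dot : dot p (window t) ≡ (p ⋆ inverse) (+ t)
    window-dot = trans (cong (dot p) (window-past t)) (dot-past p inverse (+ t) _ (n≤1+n _))
    ring : ∀ x → + 1 ℤ.* ℤ.- x ℤ.+ x ≡ + 0
    ring = solve-∀
  inverse-spec -[1+ n ]  = ⋆-causal (+ 1 ∷ p) inverse (λ _ → refl) n

-- Partitions in a box

when≤ : ℕ → ℕ → ℕ → ℕ
when≤ a n x = if a ≤ᵇ n then x else 0

when≤-yes : ∀ {a n} x → a ≤ n → when≤ a n x ≡ x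
when≤-yes {a} {n} x a≤n with a ≤ᵇ n | ≤⇒≤ᵇ a≤n
... | true | _ = refl

when≤-no : ∀ {a n} x → ¬ a ≤ n → when≤ a n x ≡ 0
when≤-no {a} {n} x a≰n with a ≤ᵇ n in eq
... | false = refl
... | true  = ⊥-elim (a≰n (≤ᵇ⇒≤ a n (subst T (sym eq) tt)))

when≤-+ : ∀ a b n x y → when≤ a n (x + when≤ b (n ∸ a) y) ≡ when≤ a n x + when≤ (a + b) n y
when≤-+ a b n x y with a ≤? n
... | no a≰n =
  trans (when≤-no _ a≰n) (sym (cong₂ _+_ (when≤-no x a≰n) (when≤-no y (a≰n ∘ m+n≤o⇒m≤o a))))
... | yes a≤n with b ≤? n ∸ a
...   | yes b≤ = begin
  when≤ a n (x + when≤ b (n ∸ a) y) ≡⟨ when≤-yes _ a≤n ⟩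
  x + when≤ b (n ∸ a) y             ≡⟨ cong₂ _+_ (sym (when≤-yes x a≤n)) (when≤-yes y b≤) ⟩
  when≤ a n x + y                   ≡⟨ cong (λ y → when≤ a n x + y) (sym (when≤-yes y a+b≤n)) ⟩
  when≤ a n x + when≤ (a + b) n y   ∎
  where
  a+b≤n : a + b ≤ n
  a+b≤n = ≤-trans (+-monoʳ-≤ a b≤) (≤-reflexive (m+[n∸m]≡n a≤n))
...   | no b≰ = begin
  when≤ a n (x + when≤ b (n ∸ a) y) ≡⟨ when≤-yes _ a≤n ⟩
  x + when≤ b (n ∸ a) y             ≡⟨ cong₂ _+_ (sym (when≤-yes x a≤n)) (when≤-no y b≰) ⟩
  when≤ a n x + 0                   ≡⟨ cong (λ y → when≤ a n x + y) (sym (when≤-no y a+b≰n)) ⟩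
  when≤ a n x + when≤ (a + b) n y   ∎
  where
  a+b≰n : ¬ a + b ≤ n
  a+b≰n a+b≤n = b≰ (subst (_≤ n ∸ a) (m+n∸m≡n a b) (∸-monoˡ-≤ a a+b≤n))

-- A copy of pBounded whose inner sum, over the number i ≤ j of parts equal to N + 1, can be named outside Defs.
mutual
  partitions : ℕ → ℕ → ℕ → ℕ
  partitions n       m (suc N) = byLargest n N m m
  partitions zero    m zero    = 1
  partitions (suc n) m zero    = 0

  byLargest : ℕ → ℕ → ℕ → ℕ → ℕ
  byLargest n N zero    r = partitions n r N
  byLargest n N (suc j) r =
    byLargest n N j r + when≤ (suc j * suc N) n (partitions (n ∸ suc j * suc N) (r ∸ suc j) N)

mutual
  pBounded≡partitions : ∀ m {_ : T (m ≤ᵇ 5)} n N → pBounded n m N ≡ partitions n m N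
  pBounded≡partitions m zero    zero    = refl
  pBounded≡partitions m (suc n) zero    = refl
  pBounded≡partitions 0 zero    (suc N) = pBounded≡partitions 0 zero N
  pBounded≡partitions 1 zero    (suc N) = cong (λ x → x + 0) (pBounded≡partitions 1 zero N)
  pBounded≡partitions 2 zero    (suc N) = cong (λ x → x + 0 + 0) (pBounded≡partitions 2 zero N)
  pBounded≡partitions 3 zero    (suc N) = cong (λ x → x + 0 + 0 + 0) (pBounded≡partitions 3 zero N)
  pBounded≡partitions 4 zero    (suc N) = cong (λ x → x + 0 + 0 + 0 + 0) (pBounded≡partitions 4 zero N)
  pBounded≡partitions 5 zero    (suc N) = cong (λ x → x + 0 + 0 + 0 + 0 + 0) (pBounded≡partitions 5 zero N)
  pBounded≡partitions 0 (suc n) (suc N) = pBounded≡partitions 0 (suc n) N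
  pBounded≡partitions 1 (suc n) (suc N) =
    cong₂ _+_ (pBounded≡partitions 1 (suc n) N) (atLargest 1 0 (suc n) N)
  pBounded≡partitions 2 (suc n) (suc N) =
    cong₂ _+_ (cong₂ _+_ (pBounded≡partitions 2 (suc n) N) (atLargest 1 1 (suc n) N)) (atLargest 2 0 (suc n) N)
  pBounded≡partitions 3 (suc n) (suc N) =
    cong₂ _+_ (cong₂ _+_ (cong₂ _+_ (pBounded≡partitions 3 (suc n) N)
                                    (atLargest 1 2 (suc n) N))
                         (atLargest 2 1 (suc n) N))
              (atLargest 3 0 (suc n) N)
  pBounded≡partitions 4 (suc n) (suc N) =
    cong₂ _+_ (cong₂ _+_ (cong₂ _+_ (cong₂ _+_ (pBounded≡partitions 4 (suc n) N)
                                               (atLargest 1 3 (suc n) N))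
                                    (atLargest 2 2 (suc n) N))
                         (atLargest 3 1 (suc n) N))
              (atLargest 4 0 (suc n) N)
  pBounded≡partitions 5 (suc n) (suc N) =
    cong₂ _+_ (cong₂ _+_ (cong₂ _+_ (cong₂ _+_ (cong₂ _+_ (pBounded≡partitions 5 (suc n) N)
                                                          (atLargest 1 4 (suc n) N))
                                               (atLargest 2 3 (suc n) N))
                                    (atLargest 3 2 (suc n) N))
                         (atLargest 4 1 (suc n) N))
              (atLargest 5 0 (suc n) N)
  pBounded≡partitions (suc (suc (suc (suc (suc (suc _)))))) {()} _ (suc N)

  atLargest : ∀ j k {_ : T (k ≤ᵇ 5)} n N →
              when≤ (j * suc N) n (pBounded (n ∸ j * suc N) k N)
                ≡ when≤ (j * suc N) n (partitions (n ∸ j * suc N) k N)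
  atLargest j k {k≤5} n N = cong (when≤ (j * suc N) n) (pBounded≡partitions k {k≤5} (n ∸ j * suc N) N)

byLargest-suc : ∀ n N j r →
  byLargest n N (suc j) r ≡ partitions n r N + when≤ (suc N) n (byLargest (n ∸ suc N) N j (r ∸ 1))
byLargest-suc n N zero    r =
  cong (λ a → partitions n r N + when≤ a n (partitions (n ∸ a) (r ∸ 1) N)) (*-identityˡ (suc N))
byLargest-suc n N (suc j) r = begin
  byLargest n N (suc j) r + when≤ a n (partitions (n ∸ a) (r ∸ suc (suc j)) N)
    ≡⟨ cong₂ _+_ (byLargest-suc n N j r)
                 (cong₂ (λ u v → when≤ a n (partitions u v N))
                        (sym (∸-+-assoc n (suc N) _)) (sym (∸-+-assoc r 1 (suc j)))) ⟩
  partitions n r N + when≤ (suc N) n B + when≤ (suc N + suc j * suc N) n L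
    ≡⟨ +-assoc (partitions n r N) _ _ ⟩
  partitions n r N + (when≤ (suc N) n B + when≤ (suc N + suc j * suc N) n L)
    ≡⟨ cong (λ x → partitions n r N + x) (sym (when≤-+ (suc N) (suc j * suc N) n B L)) ⟩
  partitions n r N + when≤ (suc N) n (B + when≤ (suc j * suc N) (n ∸ suc N) L) ∎
  where
  a = suc N + suc j * suc N
  B = byLargest (n ∸ suc N) N j (r ∸ 1)
  L = partitions (n ∸ suc N ∸ suc j * suc N) (r ∸ 1 ∸ suc j) N

partitions-pascal : ∀ n m N →
  partitions n (suc m) (suc N) ≡ partitions n (suc m) N + when≤ (suc N) n (partitions (n ∸ suc N) m (suc N))
partitions-pascal n m N = byLargest-suc n N m (suc m)

partitions-stable : ∀ d {k m N} → k ≤ N → partitions k (suc m) N ≡ partitions k (suc m) (d + N)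
partitions-stable zero    k≤N = refl
partitions-stable (suc d) {k} {m} {N} k≤N = begin
  partitions k (suc m) N
    ≡⟨ partitions-stable d k≤N ⟩
  partitions k (suc m) (d + N)
    ≡⟨ sym (+-identityʳ _) ⟩
  partitions k (suc m) (d + N) + 0
    ≡⟨ cong (λ x → partitions k (suc m) (d + N) + x) (sym (when≤-no _ (<⇒≱ (s≤s (≤-trans k≤N (m≤n+m N d)))))) ⟩
  partitions k (suc m) (d + N) + when≤ (suc (d + N)) k _
    ≡⟨ sym (partitions-pascal k m (d + N)) ⟩
  partitions k (suc m) (suc d + N) ∎

-- The coefficients of the Gaussian polynomial [N + m choose m]_q.
gaussian : ℕ → ℕ → Seq
gaussian m N (+ n)    = + partitions n m N
gaussian m N -[1+ _ ] = + 0

gaussian-causal : ∀ m N → Causal (gaussian m N)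
gaussian-causal m N _ = refl

gaussian-zeroʳ : ∀ m → gaussian m 0 ≗ δ
gaussian-zeroʳ m (+ zero)  = refl
gaussian-zeroʳ m (+ suc n) = refl
gaussian-zeroʳ m -[1+ n ]  = refl

gaussian-zeroˡ : ∀ N → gaussian 0 N ≗ δ
gaussian-zeroˡ zero    t          = gaussian-zeroʳ 0 t
gaussian-zeroˡ (suc N) (+ n)      = gaussian-zeroˡ N (+ n)
gaussian-zeroˡ (suc N) -[1+ n ]   = refl

gaussian-pascal : ∀ m N → gaussian (suc m) (suc N) ≗ λ t → gaussian (suc m) N t ℤ.+ gaussian m (suc N) (t ℤ.- + suc N)
gaussian-pascal m N -[1+ _ ] = refl
gaussian-pascal m N (+ n) with suc N ≤? n
... | yes N<n = begin
  + partitions n (suc m) (suc N)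
    ≡⟨ cong +_ (trans (partitions-pascal n m N) (cong (λ x → partitions n (suc m) N + x) (when≤-yes _ N<n))) ⟩
  + partitions n (suc m) N ℤ.+ gaussian m (suc N) (+ (n ∸ suc N))
    ≡⟨ cong (λ x → + partitions n (suc m) N ℤ.+ gaussian m (suc N) x) (sym (pos-∸ N<n)) ⟩
  + partitions n (suc m) N ℤ.+ gaussian m (suc N) (+ n ℤ.- + suc N) ∎
... | no  N≮n = begin
  + partitions n (suc m) (suc N)
    ≡⟨ cong +_ (trans (partitions-pascal n m N) (cong (λ x → partitions n (suc m) N + x) (when≤-no _ N≮n))) ⟩
  + partitions n (suc m) N ℤ.+ + 0
    ≡⟨ cong (λ x → + partitions n (suc m) N ℤ.+ x) (sym (causal-below (gaussian m (suc N)) (λ _ → refl) (≰⇒> N≮n))) ⟩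
  + partitions n (suc m) N ℤ.+ gaussian m (suc N) (+ n ℤ.- + suc N) ∎

range : ℕ → ℕ → List ℕ
range a zero    = []
range a (suc m) = a ∷ range (suc a) m

∇∏ : ℕ → ℕ → Seq → Seq
∇∏ m N = ∇* (range (suc N) m)

∇∏-suc : ∀ m N f → ∇∏ (suc m) N f ≗ ∇ (N + suc m) (∇∏ m N f)
∇∏-suc zero    N f t = cong (λ a → ∇ a f t) (+-comm 1 N)
∇∏-suc (suc m) N f t = begin
  ∇ (suc N) (∇∏ (suc m) (suc N) f) t                 ≡⟨ ∇-cong (suc N) (∇∏-suc m (suc N) f) t ⟩
  ∇ (suc N) (∇ (suc N + suc m) (∇∏ m (suc N) f)) t   ≡⟨ ∇-comm (suc N) (suc N + suc m) (∇∏ m (suc N) f) t ⟩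
  ∇ (suc N + suc m) (∇∏ (suc m) N f) t               ≡⟨ cong (λ a → ∇ a (∇∏ (suc m) N f) t) (sym (+-suc N (suc m))) ⟩
  ∇ (N + suc (suc m)) (∇∏ (suc m) N f) t             ∎

∇∏-δ-initial : ∀ m {N n} → n ≤ N → ∇∏ m N δ (+ n) ≡ δ (+ n)
∇∏-δ-initial zero    n≤N = refl
∇∏-δ-initial (suc m) {N} {n} n≤N = begin
  ∇∏ m (suc N) δ (+ n) ℤ.- ∇∏ m (suc N) δ (+ n ℤ.- + suc N)
    ≡⟨ cong₂ ℤ._-_ (∇∏-δ-initial m (m≤n⇒m≤1+n n≤N)) (causal-below (∇∏ m (suc N) δ) Y-causal (s≤s n≤N)) ⟩
  δ (+ n) ℤ.+ + 0 ≡⟨ ℤP.+-identityʳ _ ⟩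
  δ (+ n) ∎
  where
  Y-causal : Causal (∇∏ m (suc N) δ)
  Y-causal = ∇*-causal (range (suc (suc N)) m) δ (λ _ → refl)

gaussian-product : ∀ m N → ∇∏ m 0 (gaussian m N) ≗ ∇∏ m N δ
gaussian-product m       zero    = ∇*-cong (range 1 m) (gaussian-zeroʳ m)
gaussian-product zero    (suc N) = gaussian-zeroˡ (suc N)
gaussian-product (suc m) (suc N) t = begin
  ∇∏ (suc m) 0 (gaussian (suc m) (suc N)) t
    ≡⟨ ∇*-cong (range 1 (suc m)) (gaussian-pascal m N) t ⟩
  ∇∏ (suc m) 0 (λ x → gaussian (suc m) N x ℤ.+ gaussian m (suc N) (x ℤ.- + suc N)) t
    ≡⟨ ∇*-+ (range 1 (suc m)) _ _ t ⟩
  ∇∏ (suc m) 0 (gaussian (suc m) N) t ℤ.+ ∇∏ (suc m) 0 (λ x → gaussian m (suc N) (x ℤ.- + suc N)) t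
    ≡⟨ cong₂ ℤ._+_ (gaussian-product (suc m) N t) (∇*-shift (range 1 (suc m)) (+ suc N) _ t) ⟩
  ∇ (suc N) Y t ℤ.+ ∇∏ (suc m) 0 (gaussian m (suc N)) (t ℤ.- + suc N)
    ≡⟨ cong (λ x → ∇ (suc N) Y t ℤ.+ x)
            (trans (∇∏-suc m 0 _ _) (∇-cong (suc m) (gaussian-product m (suc N)) _)) ⟩
  ∇ (suc N) Y t ℤ.+ ∇ (suc m) Y (t ℤ.- + suc N)
    ≡⟨ sym (∇-split (suc N) (suc m) Y t) ⟩
  ∇ (suc N + suc m) Y t
    ≡⟨ sym (∇∏-suc m (suc N) δ t) ⟩
  ∇∏ (suc m) (suc N) δ t ∎
  where
  Y = ∇∏ m (suc N) δ

threeParts : Seq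
threeParts t = + p2 t 3

threeParts≈gaussian : ∀ {N} x → x ℤ.≤ + N → threeParts x ≡ gaussian 3 N x
threeParts≈gaussian     -[1+ _ ] _            = refl
threeParts≈gaussian {N} (+ k)    (ℤ.+≤+ k≤N) = cong +_ (begin
  pBounded k 3 k              ≡⟨ pBounded≡partitions 3 k k ⟩
  partitions k 3 k            ≡⟨ partitions-stable (N ∸ k) ≤-refl ⟩
  partitions k 3 (N ∸ k + k)  ≡⟨ cong (partitions k 3) (m∸n+n≡m k≤N) ⟩
  partitions k 3 N            ∎)

∇*-threeParts : ∇* (range 1 3) threeParts ≗ δ
∇*-threeParts -[1+ n ] = ∇*-causal (range 1 3) threeParts (λ _ → refl) n
∇*-threeParts (+ n)    = begin
  ∇* (range 1 3) threeParts (+ n)  ≡⟨ ∇*-local (range 1 3) (threeParts≈gaussian {n}) ⟩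
  ∇∏ 3 0 (gaussian 3 n) (+ n)      ≡⟨ gaussian-product 3 n (+ n) ⟩
  ∇∏ 3 n δ (+ n)                   ≡⟨ ∇∏-δ-initial 3 ≤-refl ⟩
  δ (+ n)                          ∎

denominator : List ℕ
denominator = 2 ∷ 3 ∷ 4 ∷ 5 ∷ []

-- ∏∇poly denominator has constant term 1, so its tail determines its inverse.
ρ⁻¹ : Seq
ρ⁻¹ = Inverse.inverse (drop 1 (∏∇poly denominator))

ρ⁻¹-causal : Causal ρ⁻¹
ρ⁻¹-causal _ = refl

∇*-ρ⁻¹ : ∇* denominator ρ⁻¹ ≗ δ
∇*-ρ⁻¹ t = trans (sym (∏∇poly-⋆ denominator ρ⁻¹ t)) (Inverse.inverse-spec (drop 1 (∏∇poly denominator)) t)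

∇-gaussian : ∀ N → ∇ 1 (gaussian 5 N) ≗ ∇∏ 5 N ρ⁻¹
∇-gaussian N =
  ∇*-injective denominator (z<s ∷ z<s ∷ z<s ∷ z<s ∷ [])
    (∇-causal 1 G (gaussian-causal 5 N)) (∇*-causal (range (suc N) 5) ρ⁻¹ ρ⁻¹-causal) same
  where
  G = gaussian 5 N
  same : ∇* denominator (∇ 1 G) ≗ ∇* denominator (∇∏ 5 N ρ⁻¹)
  same t = begin
    ∇* denominator (∇ 1 G) t               ≡⟨ ∇*-∇ denominator 1 G t ⟩
    ∇∏ 5 0 G t                             ≡⟨ gaussian-product 5 N t ⟩
    ∇∏ 5 N δ t                             ≡⟨ ∇*-cong (range (suc N) 5) (λ x → sym (∇*-ρ⁻¹ x)) t ⟩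
    ∇∏ 5 N (∇* denominator ρ⁻¹) t          ≡⟨ ∇*-∇* (range (suc N) 5) denominator ρ⁻¹ t ⟩
    ∇* denominator (∇∏ 5 N ρ⁻¹) t          ∎

-- Expanding (1 − q^(N+1)) ⋯ (1 − q^(N+m))

-- A term (s , K , d) stands for the monomial s · q^(K·N + d); the subset S ⊆ {1, …, m} contributes
-- the sign (−1)^|S|, K = |S| and d = ΣS.
Term : Set
Term = ℤ × ℕ × ℕ

Σterms : List Term → ℕ → Seq → Seq
Σterms []                N f t = + 0
Σterms ((s , K , d) ∷ L) N f t = s ℤ.* f (t ℤ.- + (K * N + d)) ℤ.+ Σterms L N f t

without1 : Term → Term
without1 (s , K , d) = (s , K , K + d)

with1 : Term → Term
with1 (s , K , d) = (ℤ.- s , suc K , suc (K + d))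

subsetTerms : ℕ → List Term
subsetTerms zero    = (+ 1 , 0 , 0) ∷ []
subsetTerms (suc m) = map without1 (subsetTerms m) ++ map with1 (subsetTerms m)

SizeBelowWeight : Term → Set
SizeBelowWeight (_ , K , d) = K ≤ d

subsetTerms-sizeBelowWeight : ∀ m → All SizeBelowWeight (subsetTerms m)
subsetTerms-sizeBelowWeight zero    = z≤n ∷ []
subsetTerms-sizeBelowWeight (suc m) =
  All.++⁺ (All.map⁺ (All.map (λ {τ} _ → m≤m+n (proj₁ (proj₂ τ)) _) (subsetTerms-sizeBelowWeight m)))
          (All.map⁺ (All.map (λ {τ} _ → s≤s (m≤m+n (proj₁ (proj₂ τ)) _)) (subsetTerms-sizeBelowWeight m)))

Σterms-++ : ∀ L₁ L₂ N f t → Σterms (L₁ ++ L₂) N f t ≡ Σterms L₁ N f t ℤ.+ Σterms L₂ N f t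
Σterms-++ []                 L₂ N f t = sym (ℤP.+-identityˡ _)
Σterms-++ ((s , K , d) ∷ L₁) L₂ N f t =
  trans (cong (λ x → s ℤ.* f (t ℤ.- + (K * N + d)) ℤ.+ x) (Σterms-++ L₁ L₂ N f t))
        (sym (ℤP.+-assoc (s ℤ.* f (t ℤ.- + (K * N + d))) _ _))

Σterms-without1 : ∀ L N f t → Σterms (map without1 L) N f t ≡ Σterms L (suc N) f t
Σterms-without1 []                N f t = refl
Σterms-without1 ((s , K , d) ∷ L) N f t =
  cong₂ ℤ._+_ (cong (λ e → s ℤ.* f (t ℤ.- + e)) (exponent K N d)) (Σterms-without1 L N f t)
  where
  exponent : ∀ K N d → K * N + (K + d) ≡ K * suc N + d
  exponent = ℕ-Ring.solve-∀

Σterms-with1 : ∀ L N f t → Σterms (map with1 L) N f t ≡ ℤ.- Σterms L (suc N) f (t ℤ.- + suc N)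
Σterms-with1 []                N f t = refl
Σterms-with1 ((s , K , d) ∷ L) N f t = begin
  ℤ.- s ℤ.* f (t ℤ.- + (suc K * N + suc (K + d))) ℤ.+ Σterms (map with1 L) N f t
    ≡⟨ cong₂ ℤ._+_ (cong (λ x → ℤ.- s ℤ.* f x) point) (Σterms-with1 L N f t) ⟩
  ℤ.- s ℤ.* f (t ℤ.- + suc N ℤ.- + (K * suc N + d)) ℤ.+ ℤ.- Σterms L (suc N) f (t ℤ.- + suc N)
    ≡⟨ ring s _ _ ⟩
  ℤ.- (s ℤ.* f (t ℤ.- + suc N ℤ.- + (K * suc N + d)) ℤ.+ Σterms L (suc N) f (t ℤ.- + suc N)) ∎
  where
  exponent : ∀ K N d → suc K * N + suc (K + d) ≡ suc N + (K * suc N + d)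
  exponent = ℕ-Ring.solve-∀
  point : t ℤ.- + (suc K * N + suc (K + d)) ≡ t ℤ.- + suc N ℤ.- + (K * suc N + d)
  point = trans (cong (λ e → t ℤ.- + e) (exponent K N d)) (sym (i-m-n≡i-[m+n] t (suc N) _))
  ring : ∀ s x y → ℤ.- s ℤ.* x ℤ.+ ℤ.- y ≡ ℤ.- (s ℤ.* x ℤ.+ y)
  ring = solve-∀

∇∏-expansion : ∀ m N f → ∇∏ m N f ≗ Σterms (subsetTerms m) N f
∇∏-expansion zero    N f t = sym (trans (ℤP.+-identityʳ _) (trans (ℤP.*-identityˡ _) (cong f (ℤP.+-identityʳ t))))
∇∏-expansion (suc m) N f t = sym (begin
  Σterms (map without1 S ++ map with1 S) N f t
    ≡⟨ Σterms-++ (map without1 S) _ N f t ⟩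
  Σterms (map without1 S) N f t ℤ.+ Σterms (map with1 S) N f t
    ≡⟨ cong₂ ℤ._+_ (Σterms-without1 S N f t) (Σterms-with1 S N f t) ⟩
  Σterms S (suc N) f t ℤ.- Σterms S (suc N) f (t ℤ.- + suc N)
    ≡⟨ sym (∇-cong (suc N) (∇∏-expansion m (suc N) f) t) ⟩
  ∇∏ (suc m) N f t ∎)
  where
  S = subsetTerms m

-- Sampling along arithmetic progressions

-- A sample (s , k , p , q) stands for the sequence n ↦ s · f (rate k · n + p − q).
Sample : Set
Sample = ℤ × ℕ × ℕ × ℕ

sample : ℕ → ℕ → ℕ → Seq → Seq
sample a p q f (+ n)    = f (+ (a * n + p) ℤ.- + q)
sample a p q f -[1+ _ ] = + 0

Σsamples : (ℕ → ℕ) → List Sample → Seq → Seq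
Σsamples rate []                    f t = + 0
Σsamples rate ((s , k , p , q) ∷ L) f t = s ℤ.* sample (rate k) p q f t ℤ.+ Σsamples rate L f t

Σsamples-causal : ∀ rate L f → Causal (Σsamples rate L f)
Σsamples-causal rate []                    f n = refl
Σsamples-causal rate ((s , k , p , q) ∷ L) f n =
  cong₂ ℤ._+_ (ℤP.*-zeroʳ s) (Σsamples-causal rate L f n)

Σsamples-++ : ∀ rate L₁ L₂ f t → Σsamples rate (L₁ ++ L₂) f t ≡ Σsamples rate L₁ f t ℤ.+ Σsamples rate L₂ f t
Σsamples-++ rate []                     L₂ f t = sym (ℤP.+-identityˡ _)
Σsamples-++ rate ((s , k , p , q) ∷ L₁) L₂ f t =
  trans (cong (λ x → s ℤ.* sample (rate k) p q f t ℤ.+ x) (Σsamples-++ rate L₁ L₂ f t))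
        (sym (ℤP.+-assoc (s ℤ.* sample (rate k) p q f t) _ _))

∇*-sample : ∀ as a p q f n → sum as ≤ n →
            ∇* as (sample a p q f) (+ n) ≡ ∇* (map (a *_) as) f (+ (a * n + p) ℤ.- + q)
∇*-sample []       a p q f n _        = refl
∇*-sample (k ∷ as) a p q f n k+as≤n = begin
  ∇* as S (+ n) ℤ.- ∇* as S (+ n ℤ.- + k)
    ≡⟨ cong (λ x → ∇* as S (+ n) ℤ.- ∇* as S x) (pos-∸ k≤n) ⟩
  ∇* as S (+ n) ℤ.- ∇* as S (+ (n ∸ k))
    ≡⟨ cong₂ ℤ._-_ (∇*-sample as a p q f n (m+n≤o⇒n≤o k k+as≤n))
                   (∇*-sample as a p q f (n ∸ k) (m+n≤o⇒m≤o∸n (sum as) (subst (_≤ n) (+-comm k _) k+as≤n))) ⟩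
  F (+ (a * n + p) ℤ.- + q) ℤ.- F (+ (a * (n ∸ k) + p) ℤ.- + q)
    ≡⟨ cong (λ x → F (+ (a * n + p) ℤ.- + q) ℤ.- F x) point ⟩
  F (+ (a * n + p) ℤ.- + q) ℤ.- F (+ (a * n + p) ℤ.- + q ℤ.- + (a * k)) ∎
  where
  S = sample a p q f
  F = ∇* (map (a *_) as) f
  k≤n : k ≤ n
  k≤n = m+n≤o⇒m≤o k k+as≤n
  unfold : a * n + p ≡ a * (n ∸ k) + p + a * k
  unfold = begin
    a * n + p                  ≡⟨ cong (λ x → a * x + p) (sym (m∸n+n≡m k≤n)) ⟩
    a * (n ∸ k + k) + p        ≡⟨ cong (λ x → x + p) (*-distribˡ-+ a (n ∸ k) k) ⟩
    a * (n ∸ k) + a * k + p    ≡⟨ rearrange (a * (n ∸ k)) (a * k) p ⟩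
    a * (n ∸ k) + p + a * k    ∎
    where
    rearrange : ∀ x y z → x + y + z ≡ x + z + y
    rearrange = ℕ-Ring.solve-∀
  point : + (a * (n ∸ k) + p) ℤ.- + q ≡ + (a * n + p) ℤ.- + q ℤ.- + (a * k)
  point = sym (begin
    + (a * n + p) ℤ.- + q ℤ.- + (a * k)
      ≡⟨ cong (λ x → + x ℤ.- + q ℤ.- + (a * k)) unfold ⟩
    + (a * (n ∸ k) + p + a * k) ℤ.- + q ℤ.- + (a * k)
      ≡⟨ cong (λ x → x ℤ.- + q ℤ.- + (a * k)) (ℤP.pos-+ (a * (n ∸ k) + p) (a * k)) ⟩
    + (a * (n ∸ k) + p) ℤ.+ + (a * k) ℤ.- + q ℤ.- + (a * k)
      ≡⟨ ring (+ (a * (n ∸ k) + p)) (+ (a * k)) (+ q) ⟩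
    + (a * (n ∸ k) + p) ℤ.- + q ∎)
    where
    ring : ∀ x y z → x ℤ.+ y ℤ.- z ℤ.- y ≡ x ℤ.- z
    ring = solve-∀

module Annihilation (as : List ℕ) (rate bound : ℕ → ℕ) (f : Seq)
                    (annihilated : ∀ k → VanishesFrom (bound k) (∇* (map (rate k *_) as) f)) where

  Admissible : ℕ → Sample → Set
  Admissible n₀ (_ , k , p , q) = bound k + q ≤ rate k * n₀ + p

  admissible? : ∀ n₀ → Decidable (Admissible n₀)
  admissible? n₀ (_ , k , p , q) = bound k + q ≤? rate k * n₀ + p

  sample-annihilated : ∀ {n₀ k p q} → sum as ≤ n₀ → bound k + q ≤ rate k * n₀ + p →
                       VanishesFrom n₀ (∇* as (sample (rate k) p q f))
  sample-annihilated {n₀} {k} {p} {q} as≤n₀ admissible n n₀≤n = begin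
    ∇* as (sample (rate k) p q f) (+ n)                     ≡⟨ ∇*-sample as (rate k) p q f n (≤-trans as≤n₀ n₀≤n) ⟩
    ∇* (map (rate k *_) as) f (+ (rate k * n + p) ℤ.- + q)  ≡⟨ cong (∇* (map (rate k *_) as) f) (pos-∸ q≤) ⟩
    ∇* (map (rate k *_) as) f (+ (rate k * n + p ∸ q))      ≡⟨ annihilated k _ (m+n≤o⇒m≤o∸n (bound k) enough) ⟩
    + 0                                                     ∎
    where
    enough : bound k + q ≤ rate k * n + p
    enough = ≤-trans admissible (+-monoˡ-≤ p (*-monoʳ-≤ (rate k) n₀≤n))
    q≤ : q ≤ rate k * n + p
    q≤ = m+n≤o⇒n≤o (bound k) enough

  Σsamples-annihilated : ∀ {n₀} L → sum as ≤ n₀ → All (Admissible n₀) L → VanishesFrom n₀ (∇* as (Σsamples rate L f))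
  Σsamples-annihilated [] _ [] n _ = ∇*-const0 as (+ n)
  Σsamples-annihilated ((s , k , p , q) ∷ L) as≤n₀ (admissible ∷ admissibles) n n₀≤n = begin
    ∇* as (Σsamples rate ((s , k , p , q) ∷ L) f) (+ n)
      ≡⟨ ∇*-+ as (λ t → s ℤ.* S t) (Σsamples rate L f) (+ n) ⟩
    ∇* as (λ t → s ℤ.* S t) (+ n) ℤ.+ ∇* as (Σsamples rate L f) (+ n)
      ≡⟨ cong₂ ℤ._+_ (∇*-* as s S (+ n)) (Σsamples-annihilated L as≤n₀ admissibles n n₀≤n) ⟩
    s ℤ.* ∇* as S (+ n) ℤ.+ + 0
      ≡⟨ cong (λ x → s ℤ.* x ℤ.+ + 0) (sample-annihilated as≤n₀ admissible n n₀≤n) ⟩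
    s ℤ.* + 0 ℤ.+ + 0
      ≡⟨ cong (λ x → x ℤ.+ + 0) (ℤP.*-zeroʳ s) ⟩
    + 0 ∎
    where
    S = sample (rate k) p q f

recurrence : List ℕ
recurrence = 1 ∷ 3 ∷ 2 ∷ 5 ∷ []

evenRate : ℕ → ℕ
evenRate k = 2 * suc k

-- (1 − q^(2k+2)) (1 − q^(6k+6)) (1 − q^(4k+4)) (1 − q^(10k+10)) is divisible factor by factor by
-- (1 − q²) (1 − q³) (1 − q⁴) (1 − q⁵).
ρ-multiples : ℕ → List (ℕ × ℕ)
ρ-multiples k = (k , 2) ∷ (suc (2 * k) , 3) ∷ (k , 4) ∷ (suc (2 * k) , 5) ∷ []

ρ⁻¹-bound : ℕ → ℕ
ρ⁻¹-bound k = 1 + sum (map excess (ρ-multiples k))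

ρ⁻¹-annihilated : ∀ k → VanishesFrom (ρ⁻¹-bound k) (∇* (map (evenRate k *_) recurrence) ρ⁻¹)
ρ⁻¹-annihilated k =
  subst (λ as → VanishesFrom (ρ⁻¹-bound k) (∇* as ρ⁻¹)) (sym scaled)
        (∇*-multiples (ρ-multiples k) {f = ρ⁻¹} (vanishesFrom-≗ {f = δ} (λ t → sym (∇*-ρ⁻¹ t)) δ-vanishesFrom-1))
  where
  scaled : map (evenRate k *_) recurrence ≡ map scaledBy (ρ-multiples k)
  scaled = cong₂ _∷_ (e₁ k) (cong₂ _∷_ (e₃ k) (cong₂ _∷_ (e₂ k) (cong₂ _∷_ (e₅ k) refl)))
    where
    e₁ : ∀ k → 2 * suc k * 1 ≡ suc k * 2
    e₁ = ℕ-Ring.solve-∀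
    e₃ : ∀ k → 2 * suc k * 3 ≡ suc (suc (2 * k)) * 3
    e₃ = ℕ-Ring.solve-∀
    e₂ : ∀ k → 2 * suc k * 2 ≡ suc k * 4
    e₂ = ℕ-Ring.solve-∀
    e₅ : ∀ k → 2 * suc k * 5 ≡ suc (suc (2 * k)) * 5
    e₅ = ℕ-Ring.solve-∀

threeParts-annihilated : VanishesFrom 6 (∇* recurrence threeParts)
threeParts-annihilated = vanishesFrom-≗ {f = ∇ 5 δ} same (∇-vanishesFrom 5 {g = δ} δ-vanishesFrom-1)
  where
  same : ∇ 5 δ ≗ ∇* recurrence threeParts
  same t = sym (begin
    ∇ 1 (∇ 3 (∇ 2 (∇ 5 threeParts))) t  ≡⟨ ∇-cong 1 (∇-comm 3 2 (∇ 5 threeParts)) t ⟩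
    ∇* (range 1 3) (∇ 5 threeParts) t   ≡⟨ ∇*-∇ (range 1 3) 5 threeParts t ⟩
    ∇ 5 (∇* (range 1 3) threeParts) t   ≡⟨ ∇-cong 5 ∇*-threeParts t ⟩
    ∇ 5 δ t                             ∎)

module ρ⁻¹-samples = Annihilation recurrence evenRate ρ⁻¹-bound ρ⁻¹ ρ⁻¹-annihilated
module threeParts-samples = Annihilation recurrence (λ _ → 1) (λ _ → 6) threeParts (λ _ → threeParts-annihilated)

-- The case N = 4n + c, ⌊5N/2⌋ = 10n + e

-- At t = 10n + e the monomial q^(KN + d) gives a sample of rate 10 − 4K = evenRate (4 − 2K), and nothing when K ≥ 3.
sampleOf : ℕ → ℕ → Term → List Sample
sampleOf c e (s , 0 , d)                 = (s , 4 , e , d) ∷ []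
sampleOf c e (s , 1 , d)                 = (s , 2 , e , c + d) ∷ []
sampleOf c e (s , 2 , d)                 = (s , 0 , e , 2 * c + d) ∷ []
sampleOf c e (s , suc (suc (suc _)) , d) = []

samplesOf : ℕ → ℕ → List Term → List Sample
samplesOf c e []      = []
samplesOf c e (τ ∷ L) = sampleOf c e τ ++ samplesOf c e L

term-as-samples : ∀ c e n f → Causal f → e ≤ 3 * c → ∀ s K d → K ≤ d →
  s ℤ.* f (+ (10 * n + e) ℤ.- + (K * (4 * n + c) + d)) ≡ Σsamples evenRate (sampleOf c e (s , K , d)) f (+ n)
term-as-samples c e n f _ _ s 0 d _ = sym (ℤP.+-identityʳ _)
term-as-samples c e n f _ _ s 1 d _ =
  trans (cong (λ x → s ℤ.* f x) (trans (cong₂ (λ x y → + x ℤ.- + y) (e₁ n e) (e₂ n c d))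
                                       (pos[m+n]-pos[m+o]≡n-o (4 * n) _ _)))
        (sym (ℤP.+-identityʳ _))
  where
  e₁ : ∀ n e → 10 * n + e ≡ 4 * n + (6 * n + e)
  e₁ = ℕ-Ring.solve-∀
  e₂ : ∀ n c d → 1 * (4 * n + c) + d ≡ 4 * n + (c + d)
  e₂ = ℕ-Ring.solve-∀
term-as-samples c e n f _ _ s 2 d _ =
  trans (cong (λ x → s ℤ.* f x) (trans (cong₂ (λ x y → + x ℤ.- + y) (e₁ n e) (e₂ n c d))
                                       (pos[m+n]-pos[m+o]≡n-o (8 * n) _ _)))
        (sym (ℤP.+-identityʳ _))
  where
  e₁ : ∀ n e → 10 * n + e ≡ 8 * n + (2 * n + e)
  e₁ = ℕ-Ring.solve-∀
  e₂ : ∀ n c d → 2 * (4 * n + c) + d ≡ 8 * n + (2 * c + d)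
  e₂ = ℕ-Ring.solve-∀
term-as-samples c e n f f-causal e≤3c s K@(suc (suc (suc k))) d K≤d =
  trans (cong (s ℤ.*_) (causal-below f f-causal far)) (ℤP.*-zeroʳ s)
  where
  far : 10 * n + e < K * (4 * n + c) + d
  far = ≤-<-trans (≤-trans (≤-trans (+-mono-≤ (*-monoˡ-≤ n (m≤m+n 10 2)) e≤3c) (≤-reflexive (twelve n c)))
                           (*-monoˡ-≤ (4 * n + c) (m≤m+n 3 k)))
                 (m<m+n _ (≤-trans (s≤s z≤n) K≤d))
    where
    twelve : ∀ n c → 12 * n + 3 * c ≡ 3 * (4 * n + c)
    twelve = ℕ-Ring.solve-∀

Σterms-as-samples : ∀ c e n f → Causal f → e ≤ 3 * c → ∀ L → All SizeBelowWeight L →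
  Σterms L (4 * n + c) f (+ (10 * n + e)) ≡ Σsamples evenRate (samplesOf c e L) f (+ n)
Σterms-as-samples c e n f f-causal e≤3c []                []           = refl
Σterms-as-samples c e n f f-causal e≤3c ((s , K , d) ∷ L) (K≤d ∷ L-ok) =
  trans (cong₂ ℤ._+_ (term-as-samples c e n f f-causal e≤3c s K d K≤d)
                     (Σterms-as-samples c e n f f-causal e≤3c L L-ok))
        (sym (Σsamples-++ evenRate (sampleOf c e (s , K , d)) _ f (+ n)))

p3≡gaussian : ∀ m {_ : T (m ≤ᵇ 5)} N → (λ t → + p3 t m N) ≗ gaussian m N
p3≡gaussian m {m≤5} N (+ n)    = cong +_ (pBounded≡partitions m {m≤5} n N)
p3≡gaussian m       N -[1+ _ ] = refl

-- Both sides satisfy the recurrence from n = 11 on, so checks? only has to compare them for n < 11.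
module Case (c e : ℕ) (rhs : List Sample) where

  lhs : List Sample
  lhs = samplesOf c e (subsetTerms 5)

  difference : Seq
  difference t = Σsamples evenRate lhs ρ⁻¹ t ℤ.- Σsamples (λ _ → 1) rhs threeParts t

  checks? : Dec (e ≤ 3 * c × All (ρ⁻¹-samples.Admissible 11) lhs × All (threeParts-samples.Admissible 11) rhs
                 × All (λ n → difference (+ n) ≡ + 0) (upTo 11))
  checks? = e ≤? 3 * c ×-dec all? (ρ⁻¹-samples.admissible? 11) lhs ×-dec all? (threeParts-samples.admissible? 11) rhs
            ×-dec all? (λ n → difference (+ n) ℤ.≟ + 0) (upTo 11)

  identity′ : e ≤ 3 * c → All (ρ⁻¹-samples.Admissible 11) lhs → All (threeParts-samples.Admissible 11) rhs →
              All (λ n → difference (+ n) ≡ + 0) (upTo 11) →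
              ∀ n → Δp (+ (10 * n + e)) 5 (4 * n + c) ≡ Σsamples (λ _ → 1) rhs threeParts (+ n)
  identity′ e≤3c lhs-ok rhs-ok initial n = begin
    Δp t 5 N                            ≡⟨ ∇-cong 1 (p3≡gaussian 5 N) t ⟩
    ∇ 1 (gaussian 5 N) t                ≡⟨ ∇-gaussian N t ⟩
    ∇∏ 5 N ρ⁻¹ t                        ≡⟨ ∇∏-expansion 5 N ρ⁻¹ t ⟩
    Σterms (subsetTerms 5) N ρ⁻¹ t      ≡⟨ Σterms-as-samples c e n ρ⁻¹ ρ⁻¹-causal e≤3c _ (subsetTerms-sizeBelowWeight 5) ⟩
    Σsamples evenRate lhs ρ⁻¹ (+ n)     ≡⟨ ℤP.i-j≡0⇒i≡j _ _ (difference-zero n) ⟩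
    Σsamples (λ _ → 1) rhs threeParts (+ n) ∎
    where
    N = 4 * n + c
    t = + (10 * n + e)
    annihilated : VanishesFrom 11 (∇* recurrence difference)
    annihilated m 11≤m =
      trans (∇*-- recurrence (Σsamples evenRate lhs ρ⁻¹) (Σsamples (λ _ → 1) rhs threeParts) (+ m))
            (cong₂ ℤ._-_ (ρ⁻¹-samples.Σsamples-annihilated lhs ≤-refl lhs-ok m 11≤m)
                         (threeParts-samples.Σsamples-annihilated rhs ≤-refl rhs-ok m 11≤m))
    difference-zero : ∀ n → difference (+ n) ≡ + 0
    difference-zero =
      ∇*-vanishing⇒zero recurrence difference (z<s ∷ z<s ∷ z<s ∷ z<s ∷ [])
        (λ k → cong₂ ℤ._-_ (Σsamples-causal evenRate lhs ρ⁻¹ k) (Σsamples-causal (λ _ → 1) rhs threeParts k))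
        (λ k k<11 → All.applyUpTo⁻ (λ i → i) 11 initial k<11) annihilated

  identity : True checks? → ∀ n → Δp (+ (10 * n + e)) 5 (4 * n + c) ≡ Σsamples (λ _ → 1) rhs threeParts (+ n)
  identity ok = let e≤3c , lhs-ok , rhs-ok , initial = toWitness ok in identity′ e≤3c lhs-ok rhs-ok initial

halve : ∀ n c → (5 * (4 * n + c)) / 2 ≡ 10 * n + (5 * c) / 2
halve n c = begin
  (5 * (4 * n + c)) / 2          ≡⟨ cong (_/ 2) (regroup n c) ⟩
  (5 * c + 10 * n * 2) / 2       ≡⟨ +-distrib-/-∣ʳ (5 * c) (n∣m*n (10 * n)) ⟩
  (5 * c) / 2 + 10 * n * 2 / 2   ≡⟨ cong (λ x → (5 * c) / 2 + x) (m*n/n≡m (10 * n) 2) ⟩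
  (5 * c) / 2 + 10 * n           ≡⟨ +-comm ((5 * c) / 2) (10 * n) ⟩
  10 * n + (5 * c) / 2           ∎
  where
  regroup : ∀ n c → 5 * (4 * n + c) ≡ 5 * c + 10 * n * 2
  regroup = ℕ-Ring.solve-∀

sample-unit : ∀ q f n → + 1 ℤ.* sample 1 0 q f (+ n) ≡ f (+ n ℤ.- + q)
sample-unit q f n = trans (ℤP.*-identityˡ _) (cong (λ x → f (+ x ℤ.- + q)) (trans (+-identityʳ (1 * n)) (*-identityˡ n)))

proposition4p8 : (n : ℕ) →
    (Δp (+ ((5 * (4 * n)) / 2)) 5 (4 * n) ≡ + p2 (+ n) 3)
    × (Δp (+ ((5 * (4 * n + 1)) / 2)) 5 (4 * n + 1) ≡ + (p2 (+ n ℤ.- + 1) 3 + p2 (+ n ℤ.- + 3) 3))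
    × (Δp (+ ((5 * (4 * n + 2)) / 2)) 5 (4 * n + 2) ≡ + p2 (+ n ℤ.- + 4) 3)
    × (Δp (+ ((5 * (4 * n + 3)) / 2)) 5 (4 * n + 3) ≡ + (p2 (+ n ℤ.- + 1) 3 + p2 (+ n ℤ.- + 2) 3))
proposition4p8 n = case₀ , case₁ , case₂ , case₃
  where
  floor : ∀ c → Δp (+ ((5 * (4 * n + c)) / 2)) 5 (4 * n + c) ≡ Δp (+ (10 * n + (5 * c) / 2)) 5 (4 * n + c)
  floor c = cong (λ k → Δp (+ k) 5 (4 * n + c)) (halve n c)
  case₀ = begin
    Δp (+ ((5 * (4 * n)) / 2)) 5 (4 * n)
      ≡⟨ cong (λ N → Δp (+ ((5 * N) / 2)) 5 N) (sym (+-identityʳ (4 * n))) ⟩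
    Δp (+ ((5 * (4 * n + 0)) / 2)) 5 (4 * n + 0)
      ≡⟨ trans (floor 0) (Case.identity 0 0 ((+ 1 , 0 , 0 , 0) ∷ []) _ n) ⟩
    + 1 ℤ.* sample 1 0 0 threeParts (+ n) ℤ.+ + 0
      ≡⟨ trans (ℤP.+-identityʳ _) (trans (sample-unit 0 threeParts n) (cong threeParts (ℤP.+-identityʳ (+ n)))) ⟩
    threeParts (+ n) ∎
  case₁ = trans (floor 1) (trans (Case.identity 1 2 ((+ 1 , 0 , 0 , 1) ∷ (+ 1 , 0 , 0 , 3) ∷ []) _ n)
            (cong₂ ℤ._+_ (sample-unit 1 threeParts n) (trans (ℤP.+-identityʳ _) (sample-unit 3 threeParts n))))
  case₂ = trans (floor 2) (trans (Case.identity 2 5 ((+ 1 , 0 , 0 , 4) ∷ []) _ n)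
            (trans (ℤP.+-identityʳ _) (sample-unit 4 threeParts n)))
  case₃ = trans (floor 3) (trans (Case.identity 3 7 ((+ 1 , 0 , 0 , 1) ∷ (+ 1 , 0 , 0 , 2) ∷ []) _ n)
            (cong₂ ℤ._+_ (sample-unit 1 threeParts n) (trans (ℤP.+-identityʳ _) (sample-unit 2 threeParts n))))
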